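{- Let $k\ge2$. The linear order $<_I$ on $\mathbb{S}_k$ defined by $\pi<_I\sigma$ if and only if either $\mathrm{init}(\pi)<\mathrm{init}(\sigma)$, or $\mathrm{init}(\pi)=\mathrm{init}(\sigma)$ and $\pi<_L\sigma$, induces a shelling order of the facets of $Sd(\partial\Delta^{k-1})$ (the facet corresponding to $\pi=\pi_1\cdots\pi_k$ being $F_\pi=\{\{\pi_1\},\{\pi_1,\pi_2\},\ldots,\{\pi_1,\ldots,\pi_{k-1}\}\}$).
   Context: $Sd(\partial\Delta^{k-1})$ is the order complex of the Boolean lattice of subsets of $[k]$ with $\emptyset$ and $[k]$ removed; its facets are exactly the $F_\pi$, $\pi\in\mathbb{S}_k$. $<_L$ is the lexicographic order on $\mathbb{S}_k$: $\pi<_L\sigma$ iff $\pi_1=\sigma_1,\ldots,\pi_{j-1}=\sigma_{j-1}$ and $\pi_j<\sigma_j$ for some $j$. $\mathrm{init}(\pi)=\min\{t:\{\pi_1,\ldots,\pi_t\}=[t]\}$. A pure simplicial complex is shellable with shelling order $F_1,\ldots,F_n$ of its facets if for all $i<j$ there exist $l<j$ and a vertex $v$ of $F_j$ with $F_i\cap F_j\subseteq F_l\cap F_j=F_j\setminus\{v\}$. -}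

module Defs where

open import Data.Nat using (ℕ; _<_; _≤_)
open import Data.Fin using (Fin; toℕ) renaming (_<_ to _<ᶠ_)
open import Data.Fin.Permutation using (Permutation′; _⟨$⟩ʳ_)
open import Data.Fin.Subset using (Subset) renaming (_∈_ to _∈ˢ_)
open import Data.Product using (Σ; ∃; _×_)
open import Data.Sum using (_⊎_)
open import Relation.Binary.PropositionalEquality using (_≡_; _≢_)
open import Function.Bundles using (_⇔_)
open import Relation.Nullary using (¬_)

-- Convention: [k] is modelled by Fin k = {0,…,k-1}; a permutation π of [k]
-- is written in one-line notation π₁⋯π_k with π_{i+1} = π ⟨$⟩ʳ i.

IsPrefixSet : ∀ {k} → Permutation′ k → ℕ → Subset k → Set
IsPrefixSet {k} π t w = ∀ (j : Fin k) → j ∈ˢ w ⇔ (∃ λ (i : Fin k) → toℕ i < t × π ⟨$⟩ʳ i ≡ j)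

PrefixIsInitial : ∀ {k} → Permutation′ k → ℕ → Set
PrefixIsInitial {k} π t =
  ∀ (j : Fin k) → (∃ λ (i : Fin k) → toℕ i < t × π ⟨$⟩ʳ i ≡ j) ⇔ (toℕ j < t)

IsInit : ∀ {k} → Permutation′ k → ℕ → Set
IsInit π t = 1 ≤ t × PrefixIsInitial π t × (∀ s → 1 ≤ s → s < t → ¬ PrefixIsInitial π s)

_<L_ : ∀ {k} → Permutation′ k → Permutation′ k → Set
_<L_ {k} π σ = ∃ λ (j : Fin k) →
  (∀ (i : Fin k) → toℕ i < toℕ j → π ⟨$⟩ʳ i ≡ σ ⟨$⟩ʳ i) × (π ⟨$⟩ʳ j) <ᶠ (σ ⟨$⟩ʳ j)

_<I_ : ∀ {k} → Permutation′ k → Permutation′ k → Set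
π <I σ = ∃ λ a → ∃ λ b → IsInit π a × IsInit σ b × (a < b ⊎ (a ≡ b × π <L σ))

_∈F_ : ∀ {k} → Subset k → Permutation′ k → Set
_∈F_ {k} w π = ∃ λ t → 1 ≤ t × t < k × IsPrefixSet π t w

IsShellingOrder : ∀ {I V : Set} → (V → I → Set) → (I → I → Set) → Set
IsShellingOrder {I} {V} _∈_ _≺_ =
  ∀ (i j : I) → i ≺ j →
    Σ I λ l → l ≺ j × Σ V λ v → v ∈ j ×
      ((∀ w → w ∈ i → w ∈ j → w ∈ l) ×
       (∀ w → (w ∈ l × w ∈ j) ⇔ (w ∈ j × w ≢ v)))

-- For π <_I σ we look for an adjacent descent σ_{t+1} < σ_t of σ such that π and σ have different
-- prefix sets of length t+1, and take l = σ with σ_t and σ_{t+1} swapped. The facets F_l and F_σ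
-- share all vertices except v = {σ_1,…,σ_{t+1}}, and v ∉ F_π, so F_π ∩ F_σ ⊆ F_l. The descent gives
-- l <_L σ, and it also shows {σ_1,…,σ_{t+1}} ≠ [t+1], so swapping cannot increase init and l <_I σ.
-- Such a t exists with d ≤ t < e whenever d < e, σ_e < σ_d and the prefix sets of π and σ differ at
-- every length in (d, e]. If π <_L σ, take for d the first position where π and σ
-- differ and for e the position of π_d in σ. If a = init(π) < init(σ), a counting argument shows that
-- σ places some value ≥ a at a position d < a and some value < a at a position e ≥ a.

{-# OPTIONS --safe #-}
module Submission where

open import Defs
open import Data.Nat using (ℕ; _≤_)
open import Data.Fin.Permutation using (Permutation′)
open import Data.Fin.Subset using (Subset)

import Data.Bool.Properties as Bool
open import Data.Fin using (Fin; zero; suc; toℕ; fromℕ<; inject≤; inject₁) renaming (_<_ to _<ᶠ_)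
import Data.Fin.Properties as Fin
open import Data.Fin.Permutation
  using (Permutation; _⟨$⟩ʳ_; _⟨$⟩ˡ_; inverseˡ; inverseʳ; id; flip; transpose; _∘ₚ_)
import Data.Fin.Permutation.Components as PC
open import Data.Fin.Subset using (_∈_; _∉_; _⊆_; _⊈_)
open import Data.Fin.Subset.Properties using (_∈?_; ⊆-antisym; ⊆-reflexive)
open import Data.Nat using (suc; _<_; _<ᵇ_; z≤n; s≤s; s≤s⁻¹)
open import Data.Nat.Properties
open import Data.Product using (Σ; ∃; _×_; _,_)
open import Data.Sum using (inj₁; inj₂)
import Data.Sum as Sum
open import Data.Vec using (tabulate)
open import Data.Vec.Properties using (lookup∘tabulate; []=⇒lookup; lookup⇒[]=; ≡-dec)
open import Function using (_∘_; _⇔_; mk⇔; Injective; Injection; Equivalence)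
open import Function.Properties.Inverse using (↔⇒↣)
import Function.Properties.Equivalence as ⇔
open import Relation.Binary.PropositionalEquality
open import Relation.Nullary using (¬_; Dec; yes; no; ¬?; decidable-stable; contradiction)
open import Relation.Nullary.Decidable using (_×-dec_)
import Relation.Nullary.Decidable as Dec

open Equivalence using (to; from)

<⇔suc< : ∀ {m s} → s ≢ suc m → m < s ⇔ suc m < s
<⇔suc< s≢1+m = mk⇔ (λ m<s → ≤∧≢⇒< m<s (s≢1+m ∘ sym)) (<-trans (n<1+n _))

injective-below⇒≤ : ∀ {k l m n} (f : Fin k → Fin l) → Injective _≡_ _≡_ f → n ≤ k →
                    (∀ i → toℕ i < n → toℕ (f i) < m) → n ≤ m
injective-below⇒≤ {n = n} f f-injective n≤k f-below = Fin.injective⇒≤ g-injective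
  where
  inject≤<n : ∀ (i : Fin n) → toℕ (inject≤ i n≤k) < n
  inject≤<n i = subst (_< n) (sym (Fin.toℕ-inject≤ i n≤k)) (Fin.toℕ<n i)
  g : Fin n → Fin _
  g i = fromℕ< (f-below (inject≤ i n≤k) (inject≤<n i))
  g-injective : Injective _≡_ _≡_ g
  g-injective {i} {j} gi≡gj = Fin.inject≤-injective n≤k n≤k i j
    (f-injective (Fin.toℕ-injective (Fin.fromℕ<-injective _ _ _ _ gi≡gj)))

⟨$⟩ʳ-injective : ∀ {m n} (σ : Permutation m n) → Injective _≡_ _≡_ (σ ⟨$⟩ʳ_)
⟨$⟩ʳ-injective σ = Injection.injective (↔⇒↣ σ)

∈⇔⇒≡ : ∀ {n} {p q : Subset n} → (∀ j → j ∈ p ⇔ j ∈ q) → p ≡ q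
∈⇔⇒≡ p⇔q = ⊆-antisym (to (p⇔q _)) (from (p⇔q _))

⊈⇒∃∈∉ : ∀ {n} {p q : Subset n} → p ⊈ q → ∃ λ x → x ∈ p × x ∉ q
⊈⇒∃∈∉ {p = p} {q} p⊈q with Fin.any? (λ x → x ∈? p ×-dec ¬? (x ∈? q))
... | yes x∈p∖q = x∈p∖q
... | no ∄ = contradiction (λ {x} x∈p → decidable-stable (x ∈? q) (λ x∉q → ∄ (x , x∈p , x∉q))) p⊈q

transpose-matchˡ : ∀ {n} (i j : Fin n) → PC.transpose i j i ≡ j
transpose-matchˡ i j with i Fin.≟ i
... | yes _ = refl
... | no i≢i = contradiction refl i≢i

transpose-unmoved : ∀ {n} {i j k : Fin n} → k ≢ i → k ≢ j → PC.transpose i j k ≡ k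
transpose-unmoved {i = i} {j} {k} k≢i k≢j with k Fin.≟ i
... | yes k≡i = contradiction k≡i k≢i
... | no _ with k Fin.≟ j
...   | yes k≡j = contradiction k≡j k≢j
...   | no _ = refl

transpose-adjacent-<⇔ : ∀ {n} (t : Fin n) {s} → s ≢ suc (toℕ t) → ∀ i →
                        toℕ (PC.transpose (suc t) (inject₁ t) i) < s ⇔ toℕ i < s
transpose-adjacent-<⇔ t {s} s≢1+t i with i Fin.≟ suc t
... | yes refl rewrite Fin.toℕ-inject₁ t = <⇔suc< s≢1+t
... | no _ with i Fin.≟ inject₁ t
...   | yes refl rewrite Fin.toℕ-inject₁ t = ⇔.sym (<⇔suc< s≢1+t)
...   | no _ = ⇔.refl

descent-between : ∀ {n} (f : Fin (suc n) → ℕ) {d e : Fin (suc n)} → toℕ d < toℕ e → f e < f d →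
                  ∃ λ (t : Fin n) → toℕ d ≤ toℕ t × suc (toℕ t) ≤ toℕ e × f (suc t) < f (inject₁ t)
descent-between f {zero} {suc zero} _ f₁<f₀ = zero , z≤n , s≤s z≤n , f₁<f₀
descent-between f {zero} {suc (suc e)} _ fe<f₀ with f (suc zero) <? f zero
... | yes f₁<f₀ = zero , z≤n , s≤s z≤n , f₁<f₀
... | no f₁≮f₀ =
  let t , _ , t<e , descent =
        descent-between (f ∘ suc) {zero} {suc e} (s≤s z≤n) (<-≤-trans fe<f₀ (≮⇒≥ f₁≮f₀))
  in suc t , z≤n , s≤s t<e , descent
descent-between {suc n} f {suc d} {suc e} (s≤s d<e) fe<fd =
  let t , d≤t , t<e , descent = descent-between (f ∘ suc) d<e fe<fd
  in suc t , s≤s d≤t , s≤s t<e , descent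

module _ {k : ℕ} where

  prefix : Permutation′ k → ℕ → Subset k
  prefix σ s = tabulate λ j → toℕ (σ ⟨$⟩ˡ j) <ᵇ s

  ∈-prefix⇔ : ∀ (σ : Permutation′ k) {s j} → j ∈ prefix σ s ⇔ toℕ (σ ⟨$⟩ˡ j) < s
  ∈-prefix⇔ σ {s} {j} = mk⇔
    (λ j∈ → <ᵇ⇒< _ _ (from Bool.T-≡ (trans (sym (lookup∘tabulate _ j)) ([]=⇒lookup j∈))))
    (λ j<s → lookup⇒[]= j _ (trans (lookup∘tabulate _ j) (to Bool.T-≡ (<⇒<ᵇ j<s))))

  image∈prefix⇔ : ∀ (σ : Permutation′ k) {s i} → σ ⟨$⟩ʳ i ∈ prefix σ s ⇔ toℕ i < s
  image∈prefix⇔ σ {s} = subst (λ i → _ ∈ prefix σ s ⇔ toℕ i < s) (inverseˡ σ) (∈-prefix⇔ σ)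

  prefix-mono : ∀ (σ : Permutation′ k) {s s′} → s ≤ s′ → prefix σ s ⊆ prefix σ s′
  prefix-mono σ s≤s′ j∈ = from (∈-prefix⇔ σ) (<-≤-trans (to (∈-prefix⇔ σ) j∈) s≤s′)

  inPrefix⇔ : ∀ (σ : Permutation′ k) {s j} → (∃ λ i → toℕ i < s × σ ⟨$⟩ʳ i ≡ j) ⇔ j ∈ prefix σ s
  inPrefix⇔ σ = mk⇔ (λ { (i , i<s , refl) → from (image∈prefix⇔ σ) i<s })
                    (λ j∈ → σ ⟨$⟩ˡ _ , to (∈-prefix⇔ σ) j∈ , inverseʳ σ)

  isPrefixSet⇔ : ∀ σ {s w} → IsPrefixSet σ s w ⇔ w ≡ prefix σ s
  isPrefixSet⇔ σ = mk⇔ (λ w-is → ∈⇔⇒≡ λ j → ⇔.trans (w-is j) (inPrefix⇔ σ))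
                       (λ { refl j → ⇔.sym (inPrefix⇔ σ) })

  prefixIsInitial⇔ : ∀ σ {s} → PrefixIsInitial σ s ⇔ prefix σ s ≡ prefix id s
  prefixIsInitial⇔ σ {s} = mk⇔
    (λ initial → ∈⇔⇒≡ λ j → ⇔.trans (⇔.sym (inPrefix⇔ σ)) (⇔.trans (initial j) (⇔.sym (∈-prefix⇔ id))))
    (λ σ≡id j → ⇔.trans (inPrefix⇔ σ) (subst (λ p → j ∈ p ⇔ toℕ j < s) (sym σ≡id) (∈-prefix⇔ id)))

  prefixIsInitial? : ∀ σ s → Dec (PrefixIsInitial σ s)
  prefixIsInitial? σ s = Dec.map (⇔.sym (prefixIsInitial⇔ σ)) (≡-dec Bool._≟_ (prefix σ s) (prefix id s))

  prefixIsInitial-cong : ∀ ρ σ {s} → prefix ρ s ≡ prefix σ s → PrefixIsInitial σ s → PrefixIsInitial ρ s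
  prefixIsInitial-cong ρ σ ρ≡σ = from (prefixIsInitial⇔ ρ) ∘ trans ρ≡σ ∘ to (prefixIsInitial⇔ σ)

  prefixIsInitial⇒< : ∀ σ {s i i′} → PrefixIsInitial σ s → toℕ i < s → s ≤ toℕ i′ →
                      σ ⟨$⟩ʳ i <ᶠ σ ⟨$⟩ʳ i′
  prefixIsInitial⇒< σ {s} {i} {i′} initial i<s s≤i′ = <-≤-trans σi<s s≤σi′
    where
    σ≡id = to (prefixIsInitial⇔ σ) initial
    σi<s : toℕ (σ ⟨$⟩ʳ i) < s
    σi<s = to (∈-prefix⇔ id) (subst (σ ⟨$⟩ʳ i ∈_) σ≡id (from (image∈prefix⇔ σ) i<s))
    s≤σi′ : s ≤ toℕ (σ ⟨$⟩ʳ i′)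
    s≤σi′ = ≮⇒≥ λ σi′<s →
      ≤⇒≯ s≤i′ (to (image∈prefix⇔ σ) (subst (σ ⟨$⟩ʳ i′ ∈_) (sym σ≡id) (from (∈-prefix⇔ id) σi′<s)))

  isInit⇒≤ : ∀ σ {a} → 1 ≤ k → IsInit σ a → a ≤ k
  isInit⇒≤ σ 1≤k (_ , _ , minimal) = ≮⇒≥ λ k<a → minimal k 1≤k k<a λ j →
    mk⇔ (λ _ → Fin.toℕ<n j) (λ _ → σ ⟨$⟩ˡ j , Fin.toℕ<n _ , inverseʳ σ)

  prefix-⊆⇒≤ : ∀ (σ ρ : Permutation′ k) {s s′} → s ≤ k → prefix σ s ⊆ prefix ρ s′ → s ≤ s′
  prefix-⊆⇒≤ σ ρ s≤k σ⊆ρ = injective-below⇒≤ ((σ ∘ₚ flip ρ) ⟨$⟩ʳ_) (⟨$⟩ʳ-injective (σ ∘ₚ flip ρ)) s≤k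
    λ i i<s → to (∈-prefix⇔ ρ) (σ⊆ρ (from (image∈prefix⇔ σ) i<s))

  prefix-injective : ∀ (σ ρ : Permutation′ k) {s s′} → s ≤ k → s′ ≤ k → prefix σ s ≡ prefix ρ s′ → s ≡ s′
  prefix-injective σ ρ s≤k s′≤k σ≡ρ =
    ≤-antisym (prefix-⊆⇒≤ σ ρ s≤k (⊆-reflexive σ≡ρ)) (prefix-⊆⇒≤ ρ σ s′≤k (⊆-reflexive (sym σ≡ρ)))

  -- If x ∈ prefix ρ s were missing from prefix σ s, then x = σ e with e ≥ s, and composing σ with the
  -- transposition of the positions s and e would map s + 1 positions into the prefix of ρ of length s.
  prefix-⊆⇒≡ : ∀ (σ ρ : Permutation′ k) {s} → s ≤ k → prefix σ s ⊆ prefix ρ s → prefix σ s ≡ prefix ρ s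
  prefix-⊆⇒≡ σ ρ {s} s≤k σ⊆ρ = ⊆-antisym σ⊆ρ ρ⊆σ
    where
    ρ⊆σ : prefix ρ s ⊆ prefix σ s
    ρ⊆σ {x} x∈ρ with toℕ (σ ⟨$⟩ˡ x) <? s
    ... | yes σ⁻¹x<s = from (∈-prefix⇔ σ) σ⁻¹x<s
    ... | no σ⁻¹x≮s = contradiction (injective-below⇒≤ (f ⟨$⟩ʳ_) (⟨$⟩ʳ-injective f) s<k f-below) 1+n≰n
      where
      e = σ ⟨$⟩ˡ x
      s≤e : s ≤ toℕ e
      s≤e = ≮⇒≥ σ⁻¹x≮s
      s<k : s < k
      s<k = ≤-<-trans s≤e (Fin.toℕ<n e)
      pos = fromℕ< s<k
      f = transpose pos e ∘ₚ σ ∘ₚ flip ρ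
      f-below : ∀ i → toℕ i < suc s → toℕ (f ⟨$⟩ʳ i) < s
      f-below i i≤s with m≤n⇒m<n∨m≡n (s≤s⁻¹ i≤s)
      ... | inj₁ i<s = subst (λ j → toℕ (ρ ⟨$⟩ˡ (σ ⟨$⟩ʳ j)) < s) (sym (transpose-unmoved i≢pos i≢e))
                             (to (∈-prefix⇔ ρ) (σ⊆ρ (from (image∈prefix⇔ σ) i<s)))
        where
        i≢pos : i ≢ pos
        i≢pos refl = <-irrefl (Fin.toℕ-fromℕ< s<k) i<s
        i≢e : i ≢ e
        i≢e refl = n≮n _ (<-≤-trans i<s s≤e)
      ... | inj₂ i≡s = subst (λ j → toℕ (ρ ⟨$⟩ˡ (σ ⟨$⟩ʳ j)) < s) (sym τi≡e) ρ⁻¹σe<s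
        where
        τi≡e : PC.transpose pos e i ≡ e
        τi≡e = trans (cong (PC.transpose pos e) (Fin.toℕ-injective (trans i≡s (sym (Fin.toℕ-fromℕ< s<k)))))
                     (transpose-matchˡ pos e)
        ρ⁻¹σe<s : toℕ (ρ ⟨$⟩ˡ (σ ⟨$⟩ʳ e)) < s
        ρ⁻¹σe<s = subst (λ y → toℕ (ρ ⟨$⟩ˡ y) < s) (sym (inverseʳ σ)) (to (∈-prefix⇔ ρ) x∈ρ)

  prefix∈F : ∀ (σ : Permutation′ k) {s} → 1 ≤ s → s < k → prefix σ s ∈F σ
  prefix∈F σ {s} 1≤s s<k = s , 1≤s , s<k , from (isPrefixSet⇔ σ) refl

  record PrefixesDifferOnlyAt (ρ σ : Permutation′ k) (T : ℕ) : Set where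
    constructor differOnlyAt
    field
      agree  : ∀ s → s ≢ T → prefix ρ s ≡ prefix σ s
      differ : prefix ρ T ≢ prefix σ T

  ∈F-∩-⊆ : ∀ {ρ σ T} → PrefixesDifferOnlyAt ρ σ T → ∀ π → prefix π T ≢ prefix σ T →
           ∀ w → w ∈F π → w ∈F σ → w ∈F ρ
  ∈F-∩-⊆ {ρ} {σ} {T} (differOnlyAt agree _) π π≢σ w (s , _ , s<k , w-π) (s′ , 1≤s′ , s′<k , w-σ) =
    s′ , 1≤s′ , s′<k , from (isPrefixSet⇔ ρ) (trans w≡σ (sym (agree s′ s′≢T)))
    where
    w≡σ = to (isPrefixSet⇔ σ) w-σ
    π≡σ : prefix π s ≡ prefix σ s′
    π≡σ = trans (sym (to (isPrefixSet⇔ π) w-π)) w≡σ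
    s′≢T : s′ ≢ T
    s′≢T refl with prefix-injective π σ (<⇒≤ s<k) (<⇒≤ s′<k) π≡σ
    ... | refl = π≢σ π≡σ

  ∈F-∩⇔ : ∀ {ρ σ T} → PrefixesDifferOnlyAt ρ σ T → T ≤ k →
          ∀ w → (w ∈F ρ × w ∈F σ) ⇔ (w ∈F σ × w ≢ prefix σ T)
  ∈F-∩⇔ {ρ} {σ} {T} (differOnlyAt agree differ) T≤k w = mk⇔ ∩⊆∖v ∖v⊆∩
    where
    ∩⊆∖v : w ∈F ρ × w ∈F σ → w ∈F σ × w ≢ prefix σ T
    ∩⊆∖v ((s , _ , s<k , w-ρ) , w∈σ) = w∈σ , λ w≡σ → differAt (trans (sym (to (isPrefixSet⇔ ρ) w-ρ)) w≡σ)
      where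
      differAt : prefix ρ s ≢ prefix σ T
      differAt ρ≡σ with prefix-injective ρ σ (<⇒≤ s<k) T≤k ρ≡σ
      ... | refl = differ ρ≡σ
    ∖v⊆∩ : w ∈F σ × w ≢ prefix σ T → w ∈F ρ × w ∈F σ
    ∖v⊆∩ (w∈σ@(s , 1≤s , s<k , w-σ) , w≢σ) =
      (s , 1≤s , s<k , from (isPrefixSet⇔ ρ) (trans w≡σ (sym (agree s s≢T)))) , w∈σ
      where
      w≡σ = to (isPrefixSet⇔ σ) w-σ
      s≢T : s ≢ T
      s≢T refl = w≢σ w≡σ

  -- init ρ is T when T < b and the prefix of ρ of length T is initial, and b otherwise.
  init-≤ : ∀ {ρ σ T b} → PrefixesDifferOnlyAt ρ σ T → 1 ≤ T → ¬ PrefixIsInitial σ T →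
           IsInit σ b → ∃ λ a → IsInit ρ a × a ≤ b
  init-≤ {ρ} {σ} {T} {b} (differOnlyAt agree _) 1≤T ¬σT (1≤b , σb , σ-minimal)
    with T <? b ×-dec prefixIsInitial? ρ T
  ... | yes (T<b , ρT) = T , (1≤T , ρT , ρ-minimal) , <⇒≤ T<b
    where
    ρ-minimal : ∀ s → 1 ≤ s → s < T → ¬ PrefixIsInitial ρ s
    ρ-minimal s 1≤s s<T =
      σ-minimal s 1≤s (<-trans s<T T<b) ∘ prefixIsInitial-cong σ ρ (sym (agree s (<⇒≢ s<T)))
  ... | no ¬[T<b×ρT] = b , (1≤b , prefixIsInitial-cong ρ σ (agree b b≢T) σb , ρ-minimal) , ≤-refl
    where
    b≢T : b ≢ T
    b≢T refl = ¬σT σb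
    ρ-minimal : ∀ s → 1 ≤ s → s < b → ¬ PrefixIsInitial ρ s
    ρ-minimal s 1≤s s<b ρs with s ≟ T
    ... | yes refl = ¬[T<b×ρT] (s<b , ρs)
    ... | no s≢T = σ-minimal s 1≤s s<b (prefixIsInitial-cong σ ρ (sym (agree s s≢T)) ρs)

  ShellingWitness : Permutation′ k → Permutation′ k → Set
  ShellingWitness π σ = Σ (Permutation′ k) λ l → l <I σ × Σ (Subset k) λ v → v ∈F σ ×
    ((∀ w → w ∈F π → w ∈F σ → w ∈F l) × (∀ w → (w ∈F l × w ∈F σ) ⇔ (w ∈F σ × w ≢ v)))

module _ {n : ℕ} where

  swapAt : Fin n → Permutation′ (suc n) → Permutation′ (suc n)
  swapAt t σ = transpose (inject₁ t) (suc t) ∘ₚ σ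

  swapAt-prefix : ∀ σ t {s} → s ≢ suc (toℕ t) → prefix (swapAt t σ) s ≡ prefix σ s
  swapAt-prefix σ t s≢1+t = ∈⇔⇒≡ λ j →
    ⇔.trans (∈-prefix⇔ (swapAt t σ))
            (⇔.trans (transpose-adjacent-<⇔ t s≢1+t (σ ⟨$⟩ˡ j)) (⇔.sym (∈-prefix⇔ σ)))

  swapAt-moved : ∀ σ t → swapAt t σ ⟨$⟩ʳ inject₁ t ≡ σ ⟨$⟩ʳ suc t
  swapAt-moved σ t = cong (σ ⟨$⟩ʳ_) (transpose-matchˡ (inject₁ t) (suc t))

  swapAt-prefix-≢ : ∀ σ t → prefix (swapAt t σ) (suc (toℕ t)) ≢ prefix σ (suc (toℕ t))
  swapAt-prefix-≢ σ t swap≡σ = n≮n _ (to (image∈prefix⇔ σ) (subst (σ ⟨$⟩ʳ suc t ∈_) swap≡σ moved∈swap))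
    where
    moved∈swap : σ ⟨$⟩ʳ suc t ∈ prefix (swapAt t σ) (suc (toℕ t))
    moved∈swap = subst (_∈ prefix (swapAt t σ) (suc (toℕ t))) (swapAt-moved σ t)
      (from (image∈prefix⇔ (swapAt t σ)) (Fin.≤̄⇒inject₁< {i = t} ≤-refl))

  swapAt-differOnlyAt : ∀ σ t → PrefixesDifferOnlyAt (swapAt t σ) σ (suc (toℕ t))
  swapAt-differOnlyAt σ t = differOnlyAt (λ _ → swapAt-prefix σ t) (swapAt-prefix-≢ σ t)

  swapAt-<L : ∀ (σ : Permutation′ (suc n)) t → σ ⟨$⟩ʳ suc t <ᶠ σ ⟨$⟩ʳ inject₁ t → swapAt t σ <L σ
  swapAt-<L σ t descent =
    inject₁ t , unmoved , subst (_<ᶠ σ ⟨$⟩ʳ inject₁ t) (sym (swapAt-moved σ t)) descent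
    where
    unmoved : ∀ i → toℕ i < toℕ (inject₁ t) → swapAt t σ ⟨$⟩ʳ i ≡ σ ⟨$⟩ʳ i
    unmoved i i<t = cong (σ ⟨$⟩ʳ_)
      (transpose-unmoved (Fin.<⇒≢ i<t) (Fin.<⇒≢ (<-trans i<t (Fin.≤̄⇒inject₁< {i = t} ≤-refl))))

  descent⇒¬prefixIsInitial : ∀ (σ : Permutation′ (suc n)) t → σ ⟨$⟩ʳ suc t <ᶠ σ ⟨$⟩ʳ inject₁ t →
                             ¬ PrefixIsInitial σ (suc (toℕ t))
  descent⇒¬prefixIsInitial σ t descent initial =
    <-asym descent (prefixIsInitial⇒< σ initial (Fin.≤̄⇒inject₁< {i = t} ≤-refl) ≤-refl)

  swapAt-<I : ∀ (σ : Permutation′ (suc n)) t {b} → IsInit σ b → σ ⟨$⟩ʳ suc t <ᶠ σ ⟨$⟩ʳ inject₁ t →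
              swapAt t σ <I σ
  swapAt-<I σ t {b} σ-init descent =
    let a , swap-init , a≤b =
          init-≤ (swapAt-differOnlyAt σ t) (s≤s z≤n) (descent⇒¬prefixIsInitial σ t descent) σ-init
    in a , b , swap-init , σ-init , Sum.map₂ (_, swapAt-<L σ t descent) (m≤n⇒m<n∨m≡n a≤b)

  shellingWitness-swapAt : ∀ (π σ : Permutation′ (suc n)) t {b} → IsInit σ b →
                           σ ⟨$⟩ʳ suc t <ᶠ σ ⟨$⟩ʳ inject₁ t →
                           prefix π (suc (toℕ t)) ≢ prefix σ (suc (toℕ t)) → ShellingWitness π σ
  shellingWitness-swapAt π σ t σ-init descent π≢σ =
    swapAt t σ , swapAt-<I σ t σ-init descent ,
    prefix σ (suc (toℕ t)) , prefix∈F σ (s≤s z≤n) T<k ,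
    ∈F-∩-⊆ (swapAt-differOnlyAt σ t) π π≢σ , ∈F-∩⇔ (swapAt-differOnlyAt σ t) (<⇒≤ T<k)
    where
    T<k : suc (toℕ t) < suc n
    T<k = s≤s (Fin.toℕ<n t)

  shellingWitness-inversion : ∀ (π σ : Permutation′ (suc n)) {b} → IsInit σ b →
                              ∀ {d e} → toℕ d < toℕ e → σ ⟨$⟩ʳ e <ᶠ σ ⟨$⟩ʳ d →
                              (∀ s → toℕ d < s → s ≤ toℕ e → prefix π s ≢ prefix σ s) →
                              ShellingWitness π σ
  shellingWitness-inversion π σ σ-init d<e σe<σd separated =
    let t , d≤t , t<e , descent = descent-between (toℕ ∘ (σ ⟨$⟩ʳ_)) d<e σe<σd
    in shellingWitness-swapAt π σ t σ-init descent (separated (suc (toℕ t)) (s≤s d≤t) t<e)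

  shellingWitness-<L : ∀ (π σ : Permutation′ (suc n)) {b} → IsInit σ b → π <L σ → ShellingWitness π σ
  shellingWitness-<L π σ σ-init (d , agree , πd<σd) =
    shellingWitness-inversion π σ σ-init d<e σe<σd separated
    where
    e = σ ⟨$⟩ˡ (π ⟨$⟩ʳ d)
    σe≡πd : σ ⟨$⟩ʳ e ≡ π ⟨$⟩ʳ d
    σe≡πd = inverseʳ σ
    e≮d : ¬ toℕ e < toℕ d
    e≮d e<d = <-irrefl (cong toℕ (⟨$⟩ʳ-injective π (trans (agree e e<d) σe≡πd))) e<d
    d≢e : toℕ d ≢ toℕ e
    d≢e d≡e = <-irrefl (cong toℕ (trans (sym σe≡πd) (cong (σ ⟨$⟩ʳ_) (sym (Fin.toℕ-injective d≡e))))) πd<σd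
    d<e : toℕ d < toℕ e
    d<e = ≤∧≢⇒< (≮⇒≥ e≮d) d≢e
    σe<σd : σ ⟨$⟩ʳ e <ᶠ σ ⟨$⟩ʳ d
    σe<σd = subst (_<ᶠ σ ⟨$⟩ʳ d) (sym σe≡πd) πd<σd
    separated : ∀ s → toℕ d < s → s ≤ toℕ e → prefix π s ≢ prefix σ s
    separated s d<s s≤e π≡σ =
      ≤⇒≯ s≤e (to (∈-prefix⇔ σ) (subst (π ⟨$⟩ʳ d ∈_) π≡σ (from (image∈prefix⇔ π) d<s)))

  shellingWitness-crossing : ∀ (π σ : Permutation′ (suc n)) {a b x y} → IsInit σ b →
                             prefix π a ≡ prefix id a →
                             y ∈ prefix σ a → y ∉ prefix id a → x ∈ prefix id a → x ∉ prefix σ a →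
                             ShellingWitness π σ
  shellingWitness-crossing π σ {a} {x = x} {y} σ-init π≡id y∈σ y∉id x∈id x∉σ =
    shellingWitness-inversion π σ σ-init (<-≤-trans d<a a≤e) σe<σd separated
    where
    d = σ ⟨$⟩ˡ y
    e = σ ⟨$⟩ˡ x
    d<a : toℕ d < a
    d<a = to (∈-prefix⇔ σ) y∈σ
    a≤e : a ≤ toℕ e
    a≤e = ≮⇒≥ (x∉σ ∘ from (∈-prefix⇔ σ))
    σe<σd : σ ⟨$⟩ʳ e <ᶠ σ ⟨$⟩ʳ d
    σe<σd = subst₂ _<ᶠ_ (sym (inverseʳ σ)) (sym (inverseʳ σ)) (<-≤-trans x<a a≤y)
      where
      x<a : toℕ x < a
      x<a = to (∈-prefix⇔ id) x∈id
      a≤y : a ≤ toℕ y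
      a≤y = ≮⇒≥ (y∉id ∘ from (∈-prefix⇔ id))
    separated : ∀ s → toℕ d < s → s ≤ toℕ e → prefix π s ≢ prefix σ s
    separated s d<s s≤e π≡σ with s ≤? a
    ... | yes s≤a =
      y∉id (subst (y ∈_) π≡id (prefix-mono π s≤a (subst (y ∈_) (sym π≡σ) (from (∈-prefix⇔ σ) d<s))))
    ... | no s≰a = ≤⇒≯ s≤e (to (∈-prefix⇔ σ)
      (subst (x ∈_) π≡σ (prefix-mono π (<⇒≤ (≰⇒> s≰a)) (subst (x ∈_) (sym π≡id) x∈id))))

  shellingWitness-init< : ∀ (π σ : Permutation′ (suc n)) {a b} → IsInit π a → IsInit σ b → a < b →
                          ShellingWitness π σ
  shellingWitness-init< π σ {a} π-init@(1≤a , πa , _) σ-init@(_ , _ , σ-minimal) a<b =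
    let y , y∈σ , y∉id = ⊈⇒∃∈∉ (σ≢id ∘ prefix-⊆⇒≡ σ id a≤k)
        x , x∈id , x∉σ = ⊈⇒∃∈∉ (σ≢id ∘ sym ∘ prefix-⊆⇒≡ id σ a≤k)
    in shellingWitness-crossing π σ {a} σ-init (to (prefixIsInitial⇔ π) πa) y∈σ y∉id x∈id x∉σ
    where
    σ≢id : prefix σ a ≢ prefix id a
    σ≢id = σ-minimal a 1≤a a<b ∘ from (prefixIsInitial⇔ σ)
    a≤k : a ≤ suc n
    a≤k = isInit⇒≤ π (s≤s z≤n) π-init

  shellingWitness : ∀ (π σ : Permutation′ (suc n)) → π <I σ → ShellingWitness π σ
  shellingWitness π σ (_ , _ , π-init , σ-init , inj₁ a<b) = shellingWitness-init< π σ π-init σ-init a<b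
  shellingWitness π σ (_ , _ , _ , σ-init , inj₂ (_ , π<σ)) = shellingWitness-<L π σ σ-init π<σ

mainTheorem15 : (k : ℕ) → 2 ≤ k → IsShellingOrder {Permutation′ k} {Subset k} _∈F_ _<I_
mainTheorem15 (suc n) _ = shellingWitness
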